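{- Let $1\le k\le n-1$ and let $F'\subseteq F^{\max}_{k,n}$ be convex and centrally symmetric. Then there exists a concave profile $H$ with $F'={\operatorname{F}}'(H)$.
   Context: $F^{\max}_{k,n}=\{(a,a+b):(a,b)\in[k-1]\times[n-k-1]\}$. A set $F'\subseteq F^{\max}_{k,n}$ is centrally symmetric if $\alpha\in F'\iff(k,n)-\alpha\in F'$, and convex if $F'\cup\{(0,0),(k,n)\}$ contains all lattice points of its convex hull. A concave profile is a sequence of reals $H=(H_0,\dots,H_n)$ with the following properties: - $H_0=0$ and $H_n=k$; - $0<H_{i+1}-H_i<1$ for all $0\le i<n$; - $H_{i+1}-H_i\ge H_{j+1}-H_j$ for all $0\le i\le j<n$; - the numbers $h_i:=H_i-\lfloor H_i\rfloor$, $0\le i<n$, are pairwise distinct. For such $H$, ${\operatorname{F}}'(H)=\{(a,b)\in[k-1]\times[n-1]: k-H_{n-b}\le a\le H_b\}$. -}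

module Defs where

open import Data.Nat as ℕ using (ℕ; zero; suc; _+_; _*_; _∸_; _≤_; _<_)
open import Data.Integer as ℤ using (ℤ; +_)
open import Data.Rational as ℚ using (ℚ; 0ℚ; 1ℚ)
open import Data.Product using (_×_; _,_; Σ; ∃)
open import Data.List using (List; []; _∷_; map)
open import Data.Nat.ListAction using (sum)
open import Data.List.Relation.Unary.All using (All)
open import Data.List.Membership.Propositional using (_∈_)
open import Relation.Binary.PropositionalEquality using (_≡_; _≢_)
open import Relation.Nullary using (¬_)
open import Function.Bundles using (_⇔_)

Point : Set
Point = ℕ × ℕ

⟦_⟧ : ℕ → ℚ
⟦ n ⟧ = (+ n) ℚ./ 1

InFmax : ℕ → ℕ → Point → Set
InFmax k n (x , y) = ∃ λ a → ∃ λ b →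
  (1 ≤ a) × (a ≤ k ∸ 1) × (1 ≤ b) × (b ≤ n ∸ k ∸ 1) × (x ≡ a) × (y ≡ a + b)

-- finite sets of lattice points are represented as lists (decidable membership)
_⊆Fmax[_,_] : List Point → ℕ → ℕ → Set
F ⊆Fmax[ k , n ] = ∀ p → p ∈ F → InFmax k n p

-- p lies in the convex hull of S: p is a convex combination of points of S.
-- Weights are rational; we clear denominators: natural weights w_i with
-- total d > 0 and Σ w_i s_i = d · p.
InConvHull : List Point → Point → Set
InConvHull S (px , py) = Σ (List (ℕ × Point)) λ ws →
  All (λ w → Data.Product.proj₂ w ∈ S) ws ×
  (0 < sum (map Data.Product.proj₁ ws)) ×
  (sum (map (λ w → Data.Product.proj₁ w * Data.Product.proj₁ (Data.Product.proj₂ w)) ws)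
     ≡ sum (map Data.Product.proj₁ ws) * px) ×
  (sum (map (λ w → Data.Product.proj₁ w * Data.Product.proj₂ (Data.Product.proj₂ w)) ws)
     ≡ sum (map Data.Product.proj₁ ws) * py)

-- convex: F ∪ {(0,0),(k,n)} contains all lattice points of its convex hull
-- (all such lattice points have nonnegative coordinates, so ℕ² suffices)
Convex : ℕ → ℕ → List Point → Set
Convex k n F = ∀ p → InConvHull ((0 , 0) ∷ (k , n) ∷ F) p → p ∈ ((0 , 0) ∷ (k , n) ∷ F)

CentrallySymmetric : ℕ → ℕ → List Point → Set
CentrallySymmetric k n F = ∀ x y → InFmax k n (x , y) →
  ((x , y) ∈ F ⇔ (k ∸ x , n ∸ y) ∈ F)

frac : ℚ → ℚ
frac q = q ℚ.- (ℚ.floor q ℚ./ 1)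

-- concave profile H = (H_0,…,H_n) (values of H at indices > n are irrelevant)
ConcaveProfile : ℕ → ℕ → (ℕ → ℚ) → Set
ConcaveProfile k n H =
  (H 0 ≡ 0ℚ) × (H n ≡ ⟦ k ⟧) ×
  (∀ i → i < n → (0ℚ ℚ.< H (suc i) ℚ.- H i) × (H (suc i) ℚ.- H i ℚ.< 1ℚ)) ×
  (∀ i j → i ≤ j → j < n → H (suc j) ℚ.- H j ℚ.≤ H (suc i) ℚ.- H i) ×
  (∀ i j → i < n → j < n → i ≢ j → frac (H i) ≢ frac (H j))

InF'H : ℕ → ℕ → (ℕ → ℚ) → Point → Set
InF'H k n H (a , b) =
  (1 ≤ a) × (a ≤ k ∸ 1) × (1 ≤ b) × (b ≤ n ∸ 1) ×
  (⟦ k ⟧ ℚ.- H (n ∸ b) ℚ.≤ ⟦ a ⟧) × (⟦ a ⟧ ℚ.≤ H b)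

module Submission where

-- Let S be F together with (0 , 0) and (k , n), points written (abscissa , height). For a
-- height t ≤ n, G t is n! times the largest abscissa at height t of a segment joining two
-- points of S, i.e. the right boundary of the convex hull of S; every segment rises by at
-- most n, so n! clears all denominators and G is integer valued. A supporting line through
-- (t , G t) and the point of S of least slope below it bounds all of S, hence all segments,
-- so G is concave; G 0 = 0, G n = k n!, and G 1 < n!, G (n − 1) < k n! make all increments
-- lie strictly between 0 and n!. By central symmetry k n! − G (n − b) is the left boundary,
-- so (a , b) lies in the hull iff n! a ≤ G b and n! k ≤ n! a + G (n − b), and convexity
-- turns this into a description of F. Finally H t = (n G t + t mod n) / (n n!). As
-- t mod n < n, an integer a satisfies a ≤ H b iff n! a ≤ G b, and k − H (n − b) ≤ a iff
-- n! k ≤ n! a + G (n − b); the perturbation keeps the increments in (0 , 1) and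
-- nonincreasing, and as the numerators of H 0 , … , H (n − 1) are distinct mod n, so are
-- their fractional parts.

open import Defs
open import Data.Nat as ℕ using (ℕ; zero; suc; z≤n; s≤s; _∸_; _%_; _!)
import Data.Nat.Properties as ℕ
import Data.Nat.DivMod as ℕ
open import Data.Nat.Divisibility using (_∣_; _∣?_; quotient; m∣n⇒n≡quotient*m; m∣m*n; ∣-trans; m≤n⇒m!∣n!)
import Data.Nat.Tactic.RingSolver as ℕ-Ring
open import Data.Integer as ℤ using (ℤ; +_; 0ℤ; 1ℤ; -1ℤ; +≤+; +<+)
import Data.Integer.Properties as ℤ
open import Data.Integer.Tactic.RingSolver using (solve-∀)
open import Data.Rational as ℚ using (ℚ; 0ℚ; 1ℚ; _/_; toℚᵘ)
import Data.Rational.Properties as ℚ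
open import Data.Rational.Unnormalised as ℚᵘ using (ℚᵘ; mkℚᵘ; *≡*; *≤*; *<*)
import Data.Rational.Unnormalised.Properties as ℚᵘ
open import Data.List using (List; []; _∷_; cartesianProduct; filter)
import Data.List.Extrema
open import Data.List.Membership.Propositional using (_∈_)
open import Data.List.Membership.Propositional.Properties
  using (∈-cartesianProduct⁺; ∈-cartesianProduct⁻; ∈-filter⁺; ∈-filter⁻)
open import Data.List.Relation.Unary.All as All using ([]; _∷_)
open import Data.List.Relation.Unary.Any using (here; there)
open import Data.Product using (Σ; _×_; _,_; proj₁; proj₂)
open import Data.Sum using (_⊎_; inj₁; inj₂)
open import Data.Empty using (⊥-elim)
open import Function.Bundles using (_⇔_; mk⇔; Equivalence)
open import Function.Properties.Equivalence using () renaming (trans to ⇔-trans)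
open import Relation.Nullary using (Dec; yes; no)
open import Relation.Nullary.Decidable using (_×-dec_)
open import Relation.Binary.Definitions using (tri<; tri≈; tri>)
open import Relation.Binary.PropositionalEquality

≤∸1⇒< : ∀ {a m} → 1 ℕ.≤ a → a ℕ.≤ m ∸ 1 → a ℕ.< m
≤∸1⇒< {m = suc m} _ a≤m = s≤s a≤m
≤∸1⇒< {suc a} {zero} _ ()

<⇒≤∸1 : ∀ {a m} → a ℕ.< m → a ℕ.≤ m ∸ 1
<⇒≤∸1 {m = suc m} (s≤s a≤m) = a≤m

n*y≤n*x+r⇔y≤x : ∀ n {x y r} → r ℕ.< n → (n ℕ.* y ℕ.≤ n ℕ.* x ℕ.+ r) ⇔ (y ℕ.≤ x)
n*y≤n*x+r⇔y≤x n {x} {y} {r} r<n =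
  mk⇔ to (λ y≤x → ℕ.≤-trans (ℕ.*-monoʳ-≤ n y≤x) (ℕ.m≤m+n (n ℕ.* x) r))
  where
  to : n ℕ.* y ℕ.≤ n ℕ.* x ℕ.+ r → y ℕ.≤ x
  to ny≤nx+r with y ℕ.≤? x
  ... | yes y≤x = y≤x
  ... | no y≰x = ⊥-elim (ℕ.<⇒≱ r<n (ℕ.+-cancelˡ-≤ (n ℕ.* x) n r (begin
    n ℕ.* x ℕ.+ n   ≡⟨ ℕ.+-comm (n ℕ.* x) n ⟩
    n ℕ.+ n ℕ.* x   ≡⟨ ℕ.*-suc n x ⟨
    n ℕ.* suc x     ≤⟨ ℕ.*-monoʳ-≤ n (ℕ.≰⇒> y≰x) ⟩
    n ℕ.* y         ≤⟨ ny≤nx+r ⟩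
    n ℕ.* x ℕ.+ r   ∎)))
    where open ℕ.≤-Reasoning

cofactor : ℕ → ℕ → ℕ
cofactor m d with d ∣? m
... | yes d∣m = quotient d∣m
... | no _ = 0

cofactor*d≡m : ∀ {m d} → d ∣ m → cofactor m d ℕ.* d ≡ m
cofactor*d≡m {m} {d} d∣m with d ∣? m
... | yes d∣m′ = sym (m∣n⇒n≡quotient*m d∣m′)
... | no d∤m = ⊥-elim (d∤m d∣m)

m≤n⇒m∣n! : ∀ {m n} → 1 ℕ.≤ m → m ℕ.≤ n → m ∣ n !
m≤n⇒m∣n! {suc m} _ m≤n = ∣-trans (m∣m*n (m !)) (m≤n⇒m!∣n! m≤n)

record FmaxBounds (k n x y : ℕ) : Set where
  field
    1≤x : 1 ℕ.≤ x
    x<k : x ℕ.< k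
    x<y : x ℕ.< y
    2≤y : 2 ℕ.≤ y
    2+y≤n : 2 ℕ.+ y ℕ.≤ n

InFmax⇒bounds : ∀ {k n x y} → InFmax k n (x , y) → FmaxBounds k n x y
InFmax⇒bounds {k} {n} (a , b , 1≤a , a≤k-1 , 1≤b , b≤n-k-1 , refl , refl) = record
  { 1≤x = 1≤a
  ; x<k = a<k
  ; x<y = ℕ.m<m+n a 1≤b
  ; 2≤y = ℕ.+-mono-≤ 1≤a 1≤b
  ; 2+y≤n = begin
      2 ℕ.+ (a ℕ.+ b)   ≡⟨ cong suc (ℕ.+-suc a b) ⟨
      suc a ℕ.+ suc b   ≤⟨ ℕ.+-mono-≤ a<k b<n-k ⟩
      k ℕ.+ (n ∸ k)     ≡⟨ ℕ.m+[n∸m]≡n (ℕ.<⇒≤ (ℕ.m∸n≢0⇒n<m {n} {k} (ℕ.m<n⇒n≢0 b<n-k))) ⟩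
      n                 ∎ }
  where
  open ℕ.≤-Reasoning
  a<k : a ℕ.< k
  a<k = ≤∸1⇒< 1≤a a≤k-1
  b<n-k : b ℕ.< n ∸ k
  b<n-k = ≤∸1⇒< 1≤b b≤n-k-1

-- Chords and convex combinations

Chord : Set
Chord = Point × Point

_spans_ : Chord → ℕ → Set
((_ , py) , (_ , qy)) spans t = py ℕ.≤ t × t ℕ.≤ qy × py ℕ.< qy

spans? : ∀ t c → Dec (c spans t)
spans? t ((_ , py) , (_ , qy)) = py ℕ.≤? t ×-dec (t ℕ.≤? qy ×-dec py ℕ.<? qy)

rise : Chord → ℕ
rise ((_ , py) , (_ , qy)) = qy ∸ py

-- rise c times the abscissa of the chord c at height t
xAt : ℕ → Chord → ℕ
xAt t ((px , py) , (qx , qy)) = (qy ∸ t) ℕ.* px ℕ.+ (t ∸ py) ℕ.* qx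

module _ {t py qy : ℕ} (sp : py ℕ.≤ t × t ℕ.≤ qy × py ℕ.< qy) where

  private
    u v : ℕ
    u = qy ∸ t
    v = t ∸ py

  rise-split : u ℕ.+ v ≡ qy ∸ py
  rise-split = trans (sym (ℕ.+-∸-assoc u (proj₁ sp))) (cong (_∸ py) (ℕ.m∸n+n≡m (proj₁ (proj₂ sp))))

  0<rise : 0 ℕ.< qy ∸ py
  0<rise = ℕ.m<n⇒0<n∸m (proj₂ (proj₂ sp))

  weighted-height : u ℕ.* py ℕ.+ v ℕ.* qy ≡ (qy ∸ py) ℕ.* t
  weighted-height = begin
    u ℕ.* py ℕ.+ v ℕ.* qy         ≡⟨ cong (λ w → u ℕ.* py ℕ.+ v ℕ.* w) (ℕ.m+[n∸m]≡n (proj₁ (proj₂ sp))) ⟨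
    u ℕ.* py ℕ.+ v ℕ.* (t ℕ.+ u)  ≡⟨ subst (λ s → u ℕ.* py ℕ.+ v ℕ.* (s ℕ.+ u) ≡ (u ℕ.+ v) ℕ.* s)
                                          (ℕ.m+[n∸m]≡n (proj₁ sp)) (ring py u v) ⟩
    (u ℕ.+ v) ℕ.* t               ≡⟨ cong (ℕ._* t) rise-split ⟩
    (qy ∸ py) ℕ.* t               ∎
    where
    open ≡-Reasoning
    ring : ∀ py u v → u ℕ.* py ℕ.+ v ℕ.* ((py ℕ.+ v) ℕ.+ u) ≡ (u ℕ.+ v) ℕ.* (py ℕ.+ v)
    ring = ℕ-Ring.solve-∀

module _ where

  open import Data.Nat using (_+_; _*_)

  -- with these weights the abscissae X₁ / r₁ ≥ a ≥ X₂ / r₂ average exactly to a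
  balance : ∀ {a r₁ r₂ X₁ X₂} → a * r₁ ℕ.≤ X₁ → X₂ ℕ.≤ a * r₂ →
    (a * r₂ ∸ X₂) * X₁ + (X₁ ∸ a * r₁) * X₂ ≡ ((a * r₂ ∸ X₂) * r₁ + (X₁ ∸ a * r₁) * r₂) * a
  balance {a} {r₁} {r₂} {X₁} {X₂} ar₁≤X₁ X₂≤ar₂ = begin
    m₂ * X₁ + m₁ * X₂              ≡⟨ cong (λ w → m₂ * w + m₁ * X₂) (ℕ.m+[n∸m]≡n ar₁≤X₁) ⟨
    m₂ * (a * r₁ + m₁) + m₁ * X₂   ≡⟨ ring₁ m₂ m₁ a r₁ X₂ ⟩
    m₂ * r₁ * a + m₁ * (X₂ + m₂)   ≡⟨ cong (λ w → m₂ * r₁ * a + m₁ * w) (ℕ.m+[n∸m]≡n X₂≤ar₂) ⟩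
    m₂ * r₁ * a + m₁ * (a * r₂)    ≡⟨ ring₂ m₂ m₁ a r₁ r₂ ⟩
    (m₂ * r₁ + m₁ * r₂) * a        ∎
    where
    open ≡-Reasoning
    m₁ m₂ : ℕ
    m₁ = X₁ ∸ a * r₁
    m₂ = a * r₂ ∸ X₂
    ring₁ : ∀ m₂ m₁ a r₁ X₂ → m₂ * (a * r₁ + m₁) + m₁ * X₂ ≡ m₂ * r₁ * a + m₁ * (X₂ + m₂)
    ring₁ = ℕ-Ring.solve-∀
    ring₂ : ∀ m₂ m₁ a r₁ r₂ → m₂ * r₁ * a + m₁ * (a * r₂) ≡ (m₂ * r₁ + m₁ * r₂) * a
    ring₂ = ℕ-Ring.solve-∀

module _ (S : List Point) {a t : ℕ} where

  open import Data.Nat using (_+_; _*_)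

  chord⇒hull : ∀ c → proj₁ c ∈ S → proj₂ c ∈ S → c spans t → xAt t c ≡ a * rise c →
               InConvHull S (a , t)
  chord⇒hull c@((px , py) , (qx , qy)) P∈S Q∈S sp X≡ar =
    (qy ∸ t , (px , py)) ∷ (t ∸ py , (qx , qy)) ∷ [] , P∈S ∷ Q∈S ∷ [] ,
    subst (0 ℕ.<_) (sym total≡rise) (0<rise sp) ,
    trans (drop+0 ((qy ∸ t) * px) ((t ∸ py) * qx))
      (trans X≡ar (trans (ℕ.*-comm a (rise c)) (cong (_* a) (sym total≡rise)))) ,
    trans (drop+0 ((qy ∸ t) * py) ((t ∸ py) * qy))
      (trans (weighted-height sp) (cong (_* t) (sym total≡rise)))
    where
    drop+0 : ∀ m n → m + (n + 0) ≡ m + n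
    drop+0 m n = cong (λ z → m + z) (ℕ.+-identityʳ n)
    total≡rise : (qy ∸ t) + ((t ∸ py) + 0) ≡ rise c
    total≡rise = trans (drop+0 (qy ∸ t) (t ∸ py)) (rise-split sp)

  twoChords⇒hull : ∀ c₁ c₂ → proj₁ c₁ ∈ S → proj₂ c₁ ∈ S → proj₁ c₂ ∈ S → proj₂ c₂ ∈ S →
    c₁ spans t → c₂ spans t → a * rise c₁ ℕ.< xAt t c₁ → xAt t c₂ ℕ.≤ a * rise c₂ →
    InConvHull S (a , t)
  twoChords⇒hull c₁@((px , py) , (qx , qy)) c₂@((px′ , py′) , (qx′ , qy′))
                 P₁∈S Q₁∈S P₂∈S Q₂∈S sp₁ sp₂ ar₁<X₁ X₂≤ar₂ =
    (m₂ * u₁ , (px , py)) ∷ (m₂ * v₁ , (qx , qy)) ∷ (m₁ * u₂ , (px′ , py′)) ∷ (m₁ * v₂ , (qx′ , qy′)) ∷ [] ,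
    P₁∈S ∷ Q₁∈S ∷ P₂∈S ∷ Q₂∈S ∷ [] , 0<total ,
    trans (regroup m₂ m₁ u₁ v₁ u₂ v₂ px qx px′ qx′)
      (trans (balance (ℕ.<⇒≤ ar₁<X₁) X₂≤ar₂) (cong (_* a) (sym total≡))) ,
    trans (regroup m₂ m₁ u₁ v₁ u₂ v₂ py qy py′ qy′)
      (trans (cong₂ (λ p q → m₂ * p + m₁ * q) (weighted-height sp₁) (weighted-height sp₂))
        (trans (ring m₂ m₁ (rise c₁) (rise c₂) t) (cong (_* t) (sym total≡))))
    where
    u₁ v₁ u₂ v₂ m₁ m₂ total : ℕ
    u₁ = qy ∸ t
    v₁ = t ∸ py
    u₂ = qy′ ∸ t
    v₂ = t ∸ py′
    m₁ = xAt t c₁ ∸ a * rise c₁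
    m₂ = a * rise c₂ ∸ xAt t c₂
    total = m₂ * u₁ + (m₂ * v₁ + (m₁ * u₂ + (m₁ * v₂ + 0)))

    regroup : ∀ m₂ m₁ u₁ v₁ u₂ v₂ z₁ w₁ z₂ w₂ →
      m₂ * u₁ * z₁ + (m₂ * v₁ * w₁ + (m₁ * u₂ * z₂ + (m₁ * v₂ * w₂ + 0)))
      ≡ m₂ * (u₁ * z₁ + v₁ * w₁) + m₁ * (u₂ * z₂ + v₂ * w₂)
    regroup = ℕ-Ring.solve-∀

    ring : ∀ m₂ m₁ r₁ r₂ t → m₂ * (r₁ * t) + m₁ * (r₂ * t) ≡ (m₂ * r₁ + m₁ * r₂) * t
    ring = ℕ-Ring.solve-∀

    total≡ : total ≡ m₂ * rise c₁ + m₁ * rise c₂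
    total≡ = trans (regroup₀ m₂ m₁ u₁ v₁ u₂ v₂)
      (cong₂ (λ p q → m₂ * p + m₁ * q) (rise-split sp₁) (rise-split sp₂))
      where
      regroup₀ : ∀ m₂ m₁ u₁ v₁ u₂ v₂ →
        m₂ * u₁ + (m₂ * v₁ + (m₁ * u₂ + (m₁ * v₂ + 0))) ≡ m₂ * (u₁ + v₁) + m₁ * (u₂ + v₂)
      regroup₀ = ℕ-Ring.solve-∀

    0<total : 0 ℕ.< total
    0<total = subst (0 ℕ.<_) (sym total≡)
      (ℕ.≤-trans (ℕ.*-mono-≤ (ℕ.m<n⇒0<n∸m ar₁<X₁) (0<rise sp₂)) (ℕ.m≤n+m (m₁ * rise c₂) (m₂ * rise c₁)))

  betweenChords⇒hull : ∀ c₁ c₂ → proj₁ c₁ ∈ S → proj₂ c₁ ∈ S → proj₁ c₂ ∈ S → proj₂ c₂ ∈ S →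
    c₁ spans t → c₂ spans t → a * rise c₁ ℕ.≤ xAt t c₁ → xAt t c₂ ℕ.≤ a * rise c₂ →
    InConvHull S (a , t)
  betweenChords⇒hull c₁ c₂ P₁∈S Q₁∈S P₂∈S Q₂∈S sp₁ sp₂ ar₁≤X₁ X₂≤ar₂ with ℕ.m≤n⇒m<n∨m≡n ar₁≤X₁
  ... | inj₁ ar₁<X₁ = twoChords⇒hull c₁ c₂ P₁∈S Q₁∈S P₂∈S Q₂∈S sp₁ sp₂ ar₁<X₁ X₂≤ar₂
  ... | inj₂ ar₁≡X₁ = chord⇒hull c₁ P₁∈S Q₁∈S sp₁ (sym ar₁≡X₁)

module _ where

  open import Data.Integer using (_+_; _*_; _-_; -_)

  ≤-byDiff : ∀ {a b c d} → a ℤ.≤ b → d - c ≡ b - a → c ℤ.≤ d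
  ≤-byDiff a≤b eq = ℤ.0≤i-j⇒j≤i (subst (0ℤ ℤ.≤_) (sym eq) (ℤ.i≤j⇒0≤j-i a≤b))

  0<j-i : ∀ {i j} → i ℤ.< j → 0ℤ ℤ.< j - i
  0<j-i {i} {j} i<j = ℤ.<-≤-trans (+<+ (s≤s z≤n)) (≤-byDiff (ℤ.i<j⇒suc[i]≤j i<j) (ring i j))
    where
    ring : ∀ i j → (j - i) - 1ℤ ≡ j - (1ℤ + i)
    ring = solve-∀

  -≤⇒≤+ : ∀ {i j l} → i - j ℤ.≤ l → i ℤ.≤ l + j
  -≤⇒≤+ {i} {j} {l} le = ≤-byDiff le (ring i j l)
    where
    ring : ∀ i j l → (l + j) - i ≡ l - (i - j)
    ring = solve-∀

  ≤+⇒-≤ : ∀ {i j l} → i ℤ.≤ l + j → i - j ℤ.≤ l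
  ≤+⇒-≤ {i} {j} {l} le = ≤-byDiff le (ring i j l)
    where
    ring : ∀ i j l → l - (i - j) ≡ (l + j) - i
    ring = solve-∀

  pos-∸ : ∀ {m n} → n ℕ.≤ m → + (m ∸ n) ≡ + m - + n
  pos-∸ {m} {n} n≤m = trans (sym (ℤ.⊖-≥ n≤m)) (sym (ℤ.m-n≡m⊖n m n))

  +i-+j≡n*w⇒i≡j : ∀ {i j n} w → i ℕ.< n → j ℕ.< n → + i - + j ≡ + n * w → i ≡ j
  +i-+j≡n*w⇒i≡j {i} {j} {n} w i<n j<n i-j≡nw =
    ℤ.+-injective (ℤ.i-j≡0⇒i≡j (+ i) (+ j) (trans i-j≡nw (trans (cong (+ n *_) w≡0) (ℤ.*-zeroʳ (+ n)))))
    where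
    i-j<n : + i - + j ℤ.< + n
    i-j<n = ℤ.≤-<-trans (ℤ.i≤j⇒i-k≤j (+ j) ℤ.≤-refl) (+<+ i<n)
    -n<i-j : - + n ℤ.< + i - + j
    -n<i-j = ℤ.<-≤-trans (ℤ.neg-mono-< (+<+ j<n)) (ℤ.i≤j⇒i≤k+j (+ i) ℤ.≤-refl)
    w<1 : w ℤ.< 1ℤ
    w<1 = ℤ.*-cancelˡ-<-nonNeg (+ n)
            (subst₂ ℤ._<_ i-j≡nw (sym (ℤ.*-identityʳ (+ n))) i-j<n)
    -1<w : -1ℤ ℤ.< w
    -1<w = ℤ.*-cancelˡ-<-nonNeg (+ n)
             (subst₂ ℤ._<_ (trans (sym (ℤ.-1*i≡-i (+ n))) (ℤ.*-comm -1ℤ (+ n))) i-j≡nw -n<i-j)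
    w≡0 : w ≡ 0ℤ
    w≡0 = ℤ.≤-antisym (ℤ.i<j⇒i≤pred[j] w<1) (ℤ.i<j⇒suc[i]≤j -1<w)

  0<n*δ+s : ∀ {n δ s} → 0ℤ ℤ.< δ → 1ℤ - + n ℤ.≤ s → 0ℤ ℤ.< + n * δ + s
  0<n*δ+s {n} {δ} {s} 0<δ 1-n≤s = ℤ.<-≤-trans (+<+ (s≤s z≤n)) (begin
    1ℤ                      ≡⟨ ring (+ n) ⟨
    + n * 1ℤ + (1ℤ - + n)   ≤⟨ ℤ.+-mono-≤ (ℤ.*-monoˡ-≤-nonNeg (+ n) (ℤ.i<j⇒suc[i]≤j 0<δ)) 1-n≤s ⟩
    + n * δ + s             ∎)
    where
    open ℤ.≤-Reasoning
    ring : ∀ n → n * 1ℤ + (1ℤ - n) ≡ 1ℤ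
    ring = solve-∀

  n*δ+s<n*d : ∀ {n δ s d} → 1 ℕ.< n → δ ℤ.< d → s ℤ.≤ 1ℤ → + n * δ + s ℤ.< + n * d
  n*δ+s<n*d {n} {δ} {s} {d} 1<n δ<d s≤1 = begin-strict
    + n * δ + s                 ≤⟨ ℤ.+-mono-≤ (ℤ.*-monoˡ-≤-nonNeg (+ n) (ℤ.i<j⇒i≤pred[j] δ<d)) s≤1 ⟩
    + n * (- 1ℤ + d) + 1ℤ       <⟨ ℤ.+-monoʳ-< (+ n * (- 1ℤ + d)) (+<+ 1<n) ⟩
    + n * (- 1ℤ + d) + + n      ≡⟨ ring (+ n) d ⟩
    + n * d                     ∎
    where
    open ℤ.≤-Reasoning
    ring : ∀ n d → n * (- 1ℤ + d) + n ≡ n * d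
    ring = solve-∀

  xAt-ℤ : ∀ {t} px py qx qy → ((px , py) , (qx , qy)) spans t →
          + xAt t ((px , py) , (qx , qy)) ≡ (+ qy - + t) * + px + (+ t - + py) * + qx
  xAt-ℤ {t} px py qx qy (py≤t , t≤qy , _) = begin
    + ((qy ∸ t) ℕ.* px ℕ.+ (t ∸ py) ℕ.* qx)   ≡⟨ ℤ.pos-+ ((qy ∸ t) ℕ.* px) ((t ∸ py) ℕ.* qx) ⟩
    + ((qy ∸ t) ℕ.* px) + + ((t ∸ py) ℕ.* qx)  ≡⟨ cong₂ _+_ (ℤ.pos-* (qy ∸ t) px) (ℤ.pos-* (t ∸ py) qx) ⟩
    + (qy ∸ t) * + px + + (t ∸ py) * + qx
      ≡⟨ cong₂ (λ u v → u * + px + v * + qx) (pos-∸ t≤qy) (pos-∸ py≤t) ⟩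
    (+ qy - + t) * + px + (+ t - + py) * + qx  ∎
    where open ≡-Reasoning

  scaledChord-ℤ : ∀ {m X t} px py qx qy → ((px , py) , (qx , qy)) spans t →
    X ℕ.* (qy ∸ py) ≡ m ℕ.* xAt t ((px , py) , (qx , qy)) →
    + X * (+ qy - + py) ≡ + m * + px * (+ qy - + t) + + m * + qx * (+ t - + py)
  scaledChord-ℤ {m} {X} {t} px py qx qy sp@(_ , _ , py<qy) eq = begin
    + X * (+ qy - + py)                                 ≡⟨ cong (+ X *_) (pos-∸ (ℕ.<⇒≤ py<qy)) ⟨
    + X * + (qy ∸ py)                                   ≡⟨ ℤ.pos-* X (qy ∸ py) ⟨
    + (X ℕ.* (qy ∸ py))                                 ≡⟨ cong +_ eq ⟩
    + (m ℕ.* xAt t ((px , py) , (qx , qy)))             ≡⟨ ℤ.pos-* m _ ⟩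
    + m * + xAt t ((px , py) , (qx , qy))               ≡⟨ cong (+ m *_) (xAt-ℤ px py qx qy sp) ⟩
    + m * ((+ qy - + t) * + px + (+ t - + py) * + qx)   ≡⟨ ring (+ m) (+ px) (+ py) (+ qx) (+ qy) (+ t) ⟩
    + m * + px * (+ qy - + t) + + m * + qx * (+ t - + py) ∎
    where
    open ≡-Reasoning
    ring : ∀ m px py qx qy t → m * ((qy - t) * px + (t - py) * qx) ≡ m * px * (qy - t) + m * qx * (t - py)
    ring = solve-∀

  -- Points are written (height , value); with τ > 0, Below y x says that (y , x) lies
  -- on or below the line through (ys , xs) and (t , v), cleared of the denominator τ.
  module LineThrough (ys xs t v : ℤ) where

    κ τ : ℤ
    κ = v - xs
    τ = t - ys

    Below : ℤ → ℤ → Set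
    Below y x = x * τ ℤ.≤ v * τ + κ * (y - t)

    below-ifSlope≥ : ∀ {y x} → κ * (t - y) ℤ.≤ (v - x) * τ → Below y x
    below-ifSlope≥ {y} {x} le = ≤-byDiff le (ring ys xs t v y x)
      where
      ring : ∀ ys xs t v y x → (v * (t - ys) + (v - xs) * (y - t)) - x * (t - ys)
                               ≡ (v - x) * (t - ys) - (v - xs) * (t - y)
      ring = solve-∀

    below-if≤v : ∀ {x} → 0ℤ ℤ.≤ τ → x ℤ.≤ v → Below t x
    below-if≤v {x} 0≤τ x≤v = ≤-byDiff (ℤ.*-monoʳ-≤-nonNeg τ {{ℤ.nonNegative 0≤τ}} x≤v) (ring ys xs t v x)
      where
      ring : ∀ ys xs t v x → (v * (t - ys) + (v - xs) * (t - t)) - x * (t - ys)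
                             ≡ v * (t - ys) - x * (t - ys)
      ring = solve-∀

    -- the chord from (ys , xs) to (y , x) meets height t at value x′
    below-ifChord≤v : ∀ {y x x′} → 0ℤ ℤ.≤ y - ys →
      x′ * (y - ys) ≡ xs * (y - t) + x * (t - ys) → x′ ℤ.≤ v → Below y x
    below-ifChord≤v {y} {x} {x′} 0≤rise chord x′≤v =
      ≤-byDiff (ℤ.*-monoʳ-≤-nonNeg (y - ys) {{ℤ.nonNegative 0≤rise}} x′≤v) (begin
        (v * τ + κ * (y - t)) - x * τ              ≡⟨ ring ys xs t v y x ⟩
        v * (y - ys) - (xs * (y - t) + x * (t - ys)) ≡⟨ cong (λ w → v * (y - ys) - w) chord ⟨
        v * (y - ys) - x′ * (y - ys)               ∎)
      where
      open ≡-Reasoning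
      ring : ∀ ys xs t v y x → (v * (t - ys) + (v - xs) * (y - t)) - x * (t - ys)
                               ≡ v * (y - ys) - (xs * (y - t) + x * (t - ys))
      ring = solve-∀

    below-interpolate : ∀ {y₁ x₁ y₂ x₂ y x} → Below y₁ x₁ → Below y₂ x₂ →
      0ℤ ℤ.≤ y₂ - y → 0ℤ ℤ.≤ y - y₁ → 0ℤ ℤ.< y₂ - y₁ →
      x * (y₂ - y₁) ≡ x₁ * (y₂ - y) + x₂ * (y - y₁) → Below y x
    below-interpolate {y₁} {x₁} {y₂} {x₂} {y} {x} below₁ below₂ 0≤y₂-y 0≤y-y₁ 0<y₂-y₁ chord =
      ℤ.*-cancelˡ-≤-pos (x * τ) (v * τ + κ * (y - t)) (y₂ - y₁) {{ℤ.positive 0<y₂-y₁}} (begin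
        (y₂ - y₁) * (x * τ)                                   ≡⟨ ring₁ x y₁ y₂ τ ⟩
        τ * (x * (y₂ - y₁))                                   ≡⟨ cong (τ *_) chord ⟩
        τ * (x₁ * (y₂ - y) + x₂ * (y - y₁))                   ≡⟨ ring₂ τ x₁ x₂ y₁ y₂ y ⟩
        (y₂ - y) * (x₁ * τ) + (y - y₁) * (x₂ * τ)
          ≤⟨ ℤ.+-mono-≤ (ℤ.*-monoˡ-≤-nonNeg (y₂ - y) {{ℤ.nonNegative 0≤y₂-y}} below₁)
                        (ℤ.*-monoˡ-≤-nonNeg (y - y₁) {{ℤ.nonNegative 0≤y-y₁}} below₂) ⟩
        (y₂ - y) * (v * τ + κ * (y₁ - t)) + (y - y₁) * (v * τ + κ * (y₂ - t)) ≡⟨ ring₃ v κ τ t y₁ y₂ y ⟩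
        (y₂ - y₁) * (v * τ + κ * (y - t))                     ∎)
      where
      open ℤ.≤-Reasoning
      ring₁ : ∀ x y₁ y₂ τ → (y₂ - y₁) * (x * τ) ≡ τ * (x * (y₂ - y₁))
      ring₁ = solve-∀
      ring₂ : ∀ τ x₁ x₂ y₁ y₂ y → τ * (x₁ * (y₂ - y) + x₂ * (y - y₁))
                                 ≡ (y₂ - y) * (x₁ * τ) + (y - y₁) * (x₂ * τ)
      ring₂ = solve-∀
      ring₃ : ∀ v κ τ t y₁ y₂ y → (y₂ - y) * (v * τ + κ * (y₁ - t)) + (y - y₁) * (v * τ + κ * (y₂ - t))
                                 ≡ (y₂ - y₁) * (v * τ + κ * (y - t))
      ring₃ = solve-∀

    below-neighbours⇒midpoint : ∀ {a b} → 0ℤ ℤ.< τ → Below (t - 1ℤ) a → Below (t + 1ℤ) b → a + b ℤ.≤ v + v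
    below-neighbours⇒midpoint {a} {b} 0<τ below₋ below₊ =
      ℤ.*-cancelˡ-≤-pos (a + b) (v + v) τ {{ℤ.positive 0<τ}} (begin
        τ * (a + b)                                        ≡⟨ ring₁ τ a b ⟩
        a * τ + b * τ                                      ≤⟨ ℤ.+-mono-≤ below₋ below₊ ⟩
        (v * τ + κ * ((t - 1ℤ) - t)) + (v * τ + κ * ((t + 1ℤ) - t)) ≡⟨ ring₂ v κ τ t ⟩
        τ * (v + v)                                        ∎)
      where
      open ℤ.≤-Reasoning
      ring₁ : ∀ τ a b → τ * (a + b) ≡ a * τ + b * τ
      ring₁ = solve-∀
      ring₂ : ∀ v κ τ t → (v * τ + κ * ((t - 1ℤ) - t)) + (v * τ + κ * ((t + 1ℤ) - t)) ≡ τ * (v + v)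
      ring₂ = solve-∀

  module OverDenominator (d-1 : ℕ) where

    private
      toℚᵘ-/ : ∀ x → toℚᵘ (x / suc d-1) ℚᵘ.≃ mkℚᵘ x d-1
      toℚᵘ-/ x = ℚ.toℚᵘ-fromℚᵘ (mkℚᵘ x d-1)

    /-mono-≤ : ∀ {x y} → x ℤ.≤ y → x / suc d-1 ℚ.≤ y / suc d-1
    /-mono-≤ {x} {y} x≤y = ℚ.toℚᵘ-cancel-≤
      (ℚᵘ.≤-respˡ-≃ (ℚᵘ.≃-sym (toℚᵘ-/ x)) (ℚᵘ.≤-respʳ-≃ (ℚᵘ.≃-sym (toℚᵘ-/ y))
        (*≤* (ℤ.*-monoʳ-≤-nonNeg (+ suc d-1) x≤y))))

    /-cancel-≤ : ∀ {x y} → x / suc d-1 ℚ.≤ y / suc d-1 → x ℤ.≤ y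
    /-cancel-≤ {x} {y} x/d≤y/d
      with ℚᵘ.≤-respˡ-≃ (toℚᵘ-/ x) (ℚᵘ.≤-respʳ-≃ (toℚᵘ-/ y) (ℚ.toℚᵘ-mono-≤ x/d≤y/d))
    ... | *≤* xd≤yd = ℤ.*-cancelʳ-≤-pos x y (+ suc d-1) xd≤yd

    /-mono-< : ∀ {x y} → x ℤ.< y → x / suc d-1 ℚ.< y / suc d-1
    /-mono-< {x} {y} x<y = ℚ.toℚᵘ-cancel-<
      (ℚᵘ.<-respˡ-≃ (ℚᵘ.≃-sym (toℚᵘ-/ x)) (ℚᵘ.<-respʳ-≃ (ℚᵘ.≃-sym (toℚᵘ-/ y))
        (*<* (ℤ.*-monoʳ-<-pos (+ suc d-1) x<y))))

    /-injective : ∀ {x y} → x / suc d-1 ≡ y / suc d-1 → x ≡ y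
    /-injective eq = ℤ.≤-antisym (/-cancel-≤ (ℚ.≤-reflexive eq)) (/-cancel-≤ (ℚ.≤-reflexive (sym eq)))

    x/d-y/d≡[x-y]/d : ∀ x y → x / suc d-1 ℚ.- y / suc d-1 ≡ (x - y) / suc d-1
    x/d-y/d≡[x-y]/d x y = ℚ.toℚᵘ-injective (ℚᵘ.≃-trans (ℚ.toℚᵘ-homo-+ (x / d) (ℚ.- (y / d)))
      (ℚᵘ.≃-trans (ℚᵘ.+-cong (toℚᵘ-/ x) (ℚᵘ.≃-trans (ℚ.toℚᵘ-homo‿- (y / d)) (ℚᵘ.-‿cong (toℚᵘ-/ y))))
        (ℚᵘ.≃-trans (*≡* common) (ℚᵘ.≃-sym (toℚᵘ-/ (x - y))))))
      where
      d = suc d-1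
      ring : ∀ x y e → (x * e + (- y) * e) * e ≡ (x - y) * (e * e)
      ring = solve-∀
      common : (x * + d + (- y) * + d) * + d ≡ (x - y) * + (d ℕ.* d)
      common = trans (ring x y (+ d)) (cong ((x - y) *_) (sym (ℤ.pos-* d d)))

    z/1≡[z*d]/d : ∀ z → z / 1 ≡ (z * + suc d-1) / suc d-1
    z/1≡[z*d]/d z = ℚ.toℚᵘ-injective (ℚᵘ.≃-trans (ℚ.toℚᵘ-fromℚᵘ (mkℚᵘ z 0))
      (ℚᵘ.≃-trans (*≡* (sym (ℤ.*-identityʳ (z * + suc d-1)))) (ℚᵘ.≃-sym (toℚᵘ-/ (z * + suc d-1)))))

    frac-/-injective-mod : ∀ x y → frac (x / suc d-1) ≡ frac (y / suc d-1) →
                           Σ ℤ λ z → x ≡ y + z * + suc d-1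
    frac-/-injective-mod x y eq = ⌊x⌋ - ⌊y⌋ , shift (/-injective (begin
      (x - ⌊x⌋ * + d) / d            ≡⟨ x/d-y/d≡[x-y]/d x (⌊x⌋ * + d) ⟨
      x / d ℚ.- (⌊x⌋ * + d) / d      ≡⟨ cong (λ w → x / d ℚ.- w) (z/1≡[z*d]/d ⌊x⌋) ⟨
      frac (x / d)                   ≡⟨ eq ⟩
      frac (y / d)                   ≡⟨ cong (λ w → y / d ℚ.- w) (z/1≡[z*d]/d ⌊y⌋) ⟩
      y / d ℚ.- (⌊y⌋ * + d) / d      ≡⟨ x/d-y/d≡[x-y]/d y (⌊y⌋ * + d) ⟩
      (y - ⌊y⌋ * + d) / d            ∎))
      where
      open ≡-Reasoning
      d = suc d-1
      ⌊x⌋ = ℚ.floor (x / d)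
      ⌊y⌋ = ℚ.floor (y / d)
      shift : x - ⌊x⌋ * + d ≡ y - ⌊y⌋ * + d → x ≡ y + (⌊x⌋ - ⌊y⌋) * + d
      shift eq′ = trans (ring₁ x ⌊x⌋ (+ d)) (trans (cong (_+ ⌊x⌋ * + d) eq′) (ring₂ y ⌊x⌋ ⌊y⌋ (+ d)))
        where
        ring₁ : ∀ x a d → x ≡ (x - a * d) + a * d
        ring₁ = solve-∀
        ring₂ : ∀ y a b d → (y - b * d) + a * d ≡ y + (a - b) * d
        ring₂ = solve-∀

module Realisation (k n : ℕ) (F : List Point) (1≤k : 1 ℕ.≤ k) (k≤n-1 : k ℕ.≤ n ∸ 1)
  (F⊆Fmax : F ⊆Fmax[ k , n ]) (convex : Convex k n F) (symmetric : CentrallySymmetric k n F) where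

  open import Data.Integer using (_+_; _*_; _-_)

  S : List Point
  S = (0 , 0) ∷ (k , n) ∷ F

  k<n : k ℕ.< n
  k<n = ≤∸1⇒< 1≤k k≤n-1

  2≤n : 2 ℕ.≤ n
  2≤n = ℕ.≤-trans (s≤s 1≤k) k<n

  1≤n : 1 ℕ.≤ n
  1≤n = ℕ.≤-trans (s≤s z≤n) 2≤n

  instance
    n≢0 : ℕ.NonZero n
    n≢0 = ℕ.>-nonZero 1≤n

  bounds : ∀ {x y} → (x , y) ∈ F → FmaxBounds k n x y
  bounds x,y∈F = InFmax⇒bounds (F⊆Fmax _ x,y∈F)

  ∈S⇒x≤k : ∀ {x y} → (x , y) ∈ S → x ℕ.≤ k
  ∈S⇒x≤k (here refl)         = z≤n
  ∈S⇒x≤k (there (here refl)) = ℕ.≤-refl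
  ∈S⇒x≤k (there (there p))   = ℕ.<⇒≤ (FmaxBounds.x<k (bounds p))

  ∈S⇒y≤n : ∀ {x y} → (x , y) ∈ S → y ℕ.≤ n
  ∈S⇒y≤n (here refl)         = z≤n
  ∈S⇒y≤n (there (here refl)) = ℕ.≤-refl
  ∈S⇒y≤n (there (there p))   = ℕ.≤-trans (ℕ.m≤n+m _ 2) (FmaxBounds.2+y≤n (bounds p))

  ∈S⇒x<y : ∀ {x y} → (x , y) ∈ S → 1 ℕ.≤ y → x ℕ.< y
  ∈S⇒x<y (here refl)         1≤y = 1≤y
  ∈S⇒x<y (there (here refl)) _   = k<n
  ∈S⇒x<y (there (there p))   _   = FmaxBounds.x<y (bounds p)

  ∈S⇒x<k : ∀ {x y} → (x , y) ∈ S → y ℕ.< n → x ℕ.< k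
  ∈S⇒x<k (here refl)         _   = 1≤k
  ∈S⇒x<k (there (here refl)) n<n = ⊥-elim (ℕ.<-irrefl refl n<n)
  ∈S⇒x<k (there (there p))   _   = FmaxBounds.x<k (bounds p)

  ∈S∧y≤1⇒origin : ∀ {x y} → (x , y) ∈ S → y ℕ.≤ 1 → x ≡ 0 × y ≡ 0
  ∈S∧y≤1⇒origin (here refl)         _   = refl , refl
  ∈S∧y≤1⇒origin (there (here refl)) n≤1 = ⊥-elim (ℕ.<⇒≱ 2≤n n≤1)
  ∈S∧y≤1⇒origin (there (there p))   y≤1 = ⊥-elim (ℕ.<⇒≱ (FmaxBounds.2≤y (bounds p)) y≤1)

  ∈S∧n≤1+y⇒top : ∀ {x y} → (x , y) ∈ S → n ℕ.≤ suc y → x ≡ k × y ≡ n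
  ∈S∧n≤1+y⇒top (here refl)         n≤1 = ⊥-elim (ℕ.<⇒≱ 2≤n n≤1)
  ∈S∧n≤1+y⇒top (there (here refl)) _   = refl , refl
  ∈S∧n≤1+y⇒top (there (there p))   n≤1+y = ⊥-elim (ℕ.<⇒≱ (FmaxBounds.2+y≤n (bounds p)) n≤1+y)

  reflect-∈S : ∀ {x y} → (x , y) ∈ S → (k ∸ x , n ∸ y) ∈ S
  reflect-∈S (here refl)         = there (here refl)
  reflect-∈S (there (here refl)) = here (cong₂ _,_ (ℕ.n∸n≡0 k) (ℕ.n∸n≡0 n))
  reflect-∈S {x} {y} (there (there p)) =
    there (there (Equivalence.to (symmetric x y (F⊆Fmax _ p)) p))

  -- The right boundary G of the convex hull of S, scaled by n!

  OnS : Chord → Set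
  OnS (P , Q) = P ∈ S × Q ∈ S

  n! : ℕ
  n! = n !

  -- n! times the abscissa of the chord c at height t
  scaledX : ℕ → Chord → ℕ
  scaledX t c = xAt t c ℕ.* cofactor n! (rise c)

  scaledX*rise : ∀ {t} c → OnS c → c spans t → scaledX t c ℕ.* rise c ≡ n! ℕ.* xAt t c
  scaledX*rise {t} c@((_ , py) , (_ , qy)) (_ , Q∈S) sp = begin
    xAt t c ℕ.* cofactor n! (rise c) ℕ.* rise c    ≡⟨ ℕ.*-assoc (xAt t c) _ _ ⟩
    xAt t c ℕ.* (cofactor n! (rise c) ℕ.* rise c)  ≡⟨ cong (xAt t c ℕ.*_) (cofactor*d≡m rise∣n!) ⟩
    xAt t c ℕ.* n!                                 ≡⟨ ℕ.*-comm (xAt t c) n! ⟩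
    n! ℕ.* xAt t c                                 ∎
    where
    open ≡-Reasoning
    rise∣n! : rise c ∣ n!
    rise∣n! = m≤n⇒m∣n! (0<rise sp) (ℕ.≤-trans (ℕ.m∸n≤m qy py) (∈S⇒y≤n Q∈S))

  spanning : ℕ → List Chord
  spanning t = filter (spans? t) (cartesianProduct S S)

  base : Chord
  base = (0 , 0) , (k , n)

  open Data.List.Extrema ℕ.≤-totalOrder using (argmax; f[xs]≤f[argmax]; argmax-all)

  -- abstract: unfolding the maximum over all chords makes typechecking blow up
  abstract

    G : ℕ → ℕ
    G t = scaledX t (argmax (scaledX t) base (spanning t))

    scaledX≤G : ∀ {t} c → OnS c → c spans t → scaledX t c ℕ.≤ G t
    scaledX≤G {t} c (P∈S , Q∈S) sp = All.lookup (f[xs]≤f[argmax] base (spanning t))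
      (∈-filter⁺ (spans? t) (∈-cartesianProduct⁺ P∈S Q∈S) sp)

    G-attained : ∀ {t} → t ℕ.≤ n →
      Σ Chord λ c → OnS c × c spans t × G t ℕ.* rise c ≡ n! ℕ.* xAt t c
    G-attained {t} t≤n = c , onS , sp , scaledX*rise c onS sp
      where
      c : Chord
      c = argmax (scaledX t) base (spanning t)
      onS×spans : OnS c × c spans t
      onS×spans = argmax-all (scaledX t) {P = λ c → OnS c × c spans t}
        ((here refl , there (here refl)) , z≤n , t≤n , 1≤n)
        (All.tabulate λ c∈ → let c∈S² , sp = ∈-filter⁻ (spans? t) c∈ in ∈-cartesianProduct⁻ S S c∈S² , sp)
      onS : OnS c
      onS = proj₁ onS×spans
      sp : c spans t
      sp = proj₂ onS×spans

  point≤G : ∀ {x y} → (x , y) ∈ S → y ℕ.< n → n! ℕ.* x ℕ.≤ G y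
  point≤G {x} {y} P∈S y<n = subst (ℕ._≤ G y) scaledX≡ (scaledX≤G c onS sp)
    where
    open ≡-Reasoning
    c : Chord
    c = (x , y) , (k , n)
    onS : OnS c
    onS = P∈S , there (here refl)
    sp : c spans y
    sp = ℕ.≤-refl , ℕ.<⇒≤ y<n , y<n
    ring : ∀ a b c → a ℕ.* (b ℕ.* c ℕ.+ 0) ≡ a ℕ.* c ℕ.* b
    ring = ℕ-Ring.solve-∀
    scaledX≡ : scaledX y c ≡ n! ℕ.* x
    scaledX≡ = ℕ.*-cancelʳ-≡ (scaledX y c) (n! ℕ.* x) (n ∸ y) {{ℕ.>-nonZero (0<rise sp)}} (begin
      scaledX y c ℕ.* (n ∸ y)                         ≡⟨ scaledX*rise c onS sp ⟩
      n! ℕ.* ((n ∸ y) ℕ.* x ℕ.+ (y ∸ y) ℕ.* k)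
        ≡⟨ cong (λ z → n! ℕ.* ((n ∸ y) ℕ.* x ℕ.+ z ℕ.* k)) (ℕ.n∸n≡0 y) ⟩
      n! ℕ.* ((n ∸ y) ℕ.* x ℕ.+ 0)                 ≡⟨ ring n! (n ∸ y) x ⟩
      n! ℕ.* x ℕ.* (n ∸ y)                         ∎)

  G0≡0 : G 0 ≡ 0
  G0≡0 with G-attained z≤n
  ... | ((px , py) , (qx , qy)) , (P∈S , _) , (py≤0 , _ , py<qy) , eq
      with ∈S∧y≤1⇒origin P∈S (ℕ.≤-trans py≤0 z≤n)
  ...   | refl , refl = ℕ.*-cancelʳ-≡ (G 0) 0 qy {{ℕ.>-nonZero py<qy}}
          (trans eq (trans (cong (n! ℕ.*_) (trans (ℕ.+-identityʳ (qy ℕ.* 0)) (ℕ.*-zeroʳ qy))) (ℕ.*-zeroʳ n!)))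

  Gn≡k*n! : G n ≡ k ℕ.* n!
  Gn≡k*n! with G-attained ℕ.≤-refl
  ... | ((px , py) , (qx , qy)) , (_ , Q∈S) , sp@(_ , n≤qy , _) , eq
      with ∈S∧n≤1+y⇒top Q∈S (ℕ.≤-trans n≤qy (ℕ.n≤1+n qy))
  ...   | refl , refl = ℕ.*-cancelʳ-≡ (G n) (k ℕ.* n!) (n ∸ py) {{ℕ.>-nonZero (0<rise sp)}} (begin
          G n ℕ.* (n ∸ py)                            ≡⟨ eq ⟩
          n! ℕ.* ((n ∸ n) ℕ.* px ℕ.+ (n ∸ py) ℕ.* k)
            ≡⟨ cong (λ z → n! ℕ.* (z ℕ.* px ℕ.+ (n ∸ py) ℕ.* k)) (ℕ.n∸n≡0 n) ⟩
          n! ℕ.* ((n ∸ py) ℕ.* k)                     ≡⟨ ring n! (n ∸ py) k ⟩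
          k ℕ.* n! ℕ.* (n ∸ py)                       ∎)
    where
    open ≡-Reasoning
    ring : ∀ a b c → a ℕ.* (b ℕ.* c) ≡ c ℕ.* a ℕ.* b
    ring = ℕ-Ring.solve-∀

  G1<n! : G 1 ℕ.< n!
  G1<n! with G-attained 1≤n
  ... | ((px , py) , (qx , qy)) , (P∈S , Q∈S) , (py≤1 , 1≤qy , _) , eq
      with ∈S∧y≤1⇒origin P∈S py≤1
  ...   | refl , refl = ℕ.*-cancelʳ-< qy (G 1) n! (begin-strict
          G 1 ℕ.* qy                                ≡⟨ eq ⟩
          n! ℕ.* ((qy ∸ 1) ℕ.* 0 ℕ.+ (qx ℕ.+ 0))
            ≡⟨ cong (n! ℕ.*_) (cong₂ ℕ._+_ (ℕ.*-zeroʳ (qy ∸ 1)) (ℕ.+-identityʳ qx)) ⟩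
          n! ℕ.* qx                                 <⟨ ℕ.*-monoʳ-< n! {{n ℕ.!≢0}} (∈S⇒x<y Q∈S 1≤qy) ⟩
          n! ℕ.* qy                                 ∎)
    where open ℕ.≤-Reasoning

  G[n-1]<k*n! : G (n ∸ 1) ℕ.< k ℕ.* n!
  G[n-1]<k*n! with G-attained (ℕ.m∸n≤m n 1)
  ... | ((px , py) , (qx , qy)) , (P∈S , Q∈S) , (_ , n-1≤qy , py<qy) , eq
      with ∈S∧n≤1+y⇒top Q∈S (ℕ.≤-trans (ℕ.m≤n+m∸n n 1) (s≤s n-1≤qy))
  ...   | refl , refl = ℕ.*-cancelʳ-< (n ∸ py) (G (n ∸ 1)) (k ℕ.* n!) (begin-strict
          G (n ∸ 1) ℕ.* (n ∸ py)    ≡⟨ eq ⟩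
          n! ℕ.* X                  <⟨ ℕ.*-monoʳ-< n! {{n ℕ.!≢0}} X<rk ⟩
          n! ℕ.* ((n ∸ py) ℕ.* k)   ≡⟨ ring n! (n ∸ py) k ⟩
          k ℕ.* n! ℕ.* (n ∸ py)     ∎)
    where
    open ℕ.≤-Reasoning
    m X : ℕ
    m = n ∸ 1 ∸ py
    X = (n ∸ (n ∸ 1)) ℕ.* px ℕ.+ m ℕ.* k
    X<rk : X ℕ.< (n ∸ py) ℕ.* k
    X<rk = begin-strict
      X                                     ≡⟨ cong (λ z → z ℕ.* px ℕ.+ m ℕ.* k) (ℕ.m∸[m∸n]≡n 1≤n) ⟩
      (px ℕ.+ 0) ℕ.+ m ℕ.* k                <⟨ ℕ.+-monoˡ-< (m ℕ.* k) (ℕ.+-monoˡ-< 0 (∈S⇒x<k P∈S py<qy)) ⟩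
      (k ℕ.+ 0) ℕ.+ m ℕ.* k                 ≡⟨ cong (ℕ._+ m ℕ.* k) (ℕ.+-identityʳ k) ⟩
      suc m ℕ.* k                          ≡⟨ cong (λ z → suc z ℕ.* k) (ℕ.∸-+-assoc n 1 py) ⟩
      suc (n ∸ suc py) ℕ.* k               ≡⟨ cong (ℕ._* k) (ℕ.+-∸-assoc 1 py<qy) ⟨
      (n ∸ py) ℕ.* k                       ∎
    ring : ∀ a b c → a ℕ.* (b ℕ.* c) ≡ c ℕ.* a ℕ.* b
    ring = ℕ-Ring.solve-∀

  -- Concavity of G

  module SupportingLine (t : ℕ) (0<t : 0 ℕ.< t) (t<n : t ℕ.< n) where

    V : ℤ
    V = + G t

    -- the slope of the segment from (y , x) to (t , G t), with denominator t − y
    slope : Point → ℚᵘ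
    slope (x , y) = mkℚᵘ (V - + n! * + x) (t ∸ suc y)

    below : List Point
    below = filter (λ P → proj₂ P ℕ.<? t) S

    open Data.List.Extrema ℚᵘ.≤-totalOrder using (argmin; f[argmin]≤f[xs]; argmin-all)

    abstract
      pivot : Point
      pivot = argmin slope (0 , 0) below

      pivot∈S×below : pivot ∈ S × proj₂ pivot ℕ.< t
      pivot∈S×below = argmin-all slope {P = λ P → P ∈ S × proj₂ P ℕ.< t}
        (here refl , 0<t) (All.tabulate (∈-filter⁻ (λ P → proj₂ P ℕ.<? t)))

      pivot-steepest : ∀ {P} → P ∈ S → proj₂ P ℕ.< t → slope pivot ℚᵘ.≤ slope P
      pivot-steepest P∈S y<t =
        All.lookup (f[argmin]≤f[xs] {f = slope} (0 , 0) below) (∈-filter⁺ (λ P → proj₂ P ℕ.<? t) P∈S y<t)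

    xs ys : ℕ
    xs = proj₁ pivot
    ys = proj₂ pivot

    open LineThrough (+ ys) (+ n! * + xs) (+ t) V public

    0<τ : 0ℤ ℤ.< τ
    0<τ = 0<j-i (+<+ (proj₂ pivot∈S×below))

    denominator : ∀ {y} → y ℕ.< t → + suc (t ∸ suc y) ≡ + t - + y
    denominator y<t = trans (cong +_ (sym (ℕ.+-∸-assoc 1 y<t))) (pos-∸ (ℕ.<⇒≤ y<t))

    steepest : ∀ {x y} → (x , y) ∈ S → y ℕ.< t → κ * (+ t - + y) ℤ.≤ (V - + n! * + x) * τ
    steepest {x} {y} P∈S y<t = subst₂ ℤ._≤_ (cong (κ *_) (denominator y<t))
      (cong ((V - + n! * + x) *_) (denominator (proj₂ pivot∈S×below)))
      (ℚᵘ.drop-*≤* (pivot-steepest P∈S y<t))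

    supports-at : ∀ {x} → (x , t) ∈ S → Below (+ t) (+ n! * + x)
    supports-at {x} P∈S = below-if≤v (ℤ.<⇒≤ 0<τ) (subst (ℤ._≤ V) (ℤ.pos-* n! x) (+≤+ (point≤G P∈S t<n)))

    supports-above : ∀ {x y} → (x , y) ∈ S → t ℕ.< y → Below (+ y) (+ n! * + x)
    supports-above {x} {y} P∈S t<y =
      below-ifChord≤v {+ y} {+ n! * + x} {+ scaledX t c} (ℤ.<⇒≤ (0<j-i (+<+ ys<y)))
        (scaledChord-ℤ {n!} {scaledX t c} {t} xs ys x y sp (scaledX*rise c onS sp)) (+≤+ (scaledX≤G c onS sp))
      where
      ys<y : ys ℕ.< y
      ys<y = ℕ.<-trans (proj₂ pivot∈S×below) t<y
      c : Chord
      c = (xs , ys) , (x , y)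
      onS : OnS c
      onS = proj₁ pivot∈S×below , P∈S
      sp : c spans t
      sp = ℕ.<⇒≤ (proj₂ pivot∈S×below) , ℕ.<⇒≤ t<y , ys<y

    supports : ∀ {x y} → (x , y) ∈ S → Below (+ y) (+ n! * + x)
    supports {x} {y} P∈S with ℕ.<-cmp y t
    ... | tri< y<t _ _ = below-ifSlope≥ {+ y} {+ n! * + x} (steepest P∈S y<t)
    ... | tri≈ _ refl _ = supports-at P∈S
    ... | tri> _ _ t<y = supports-above P∈S t<y

    G-belowLine : ∀ {u} → u ℕ.≤ n → Below (+ u) (+ G u)
    G-belowLine {u} u≤n with G-attained u≤n
    ... | ((px , py) , (qx , qy)) , (P∈S , Q∈S) , sp@(py≤u , u≤qy , py<qy) , eq =
      below-interpolate {+ py} {+ n! * + px} {+ qy} {+ n! * + qx} {+ u} {+ G u} (supports P∈S) (supports Q∈S)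
        (ℤ.i≤j⇒0≤j-i (+≤+ u≤qy)) (ℤ.i≤j⇒0≤j-i (+≤+ py≤u)) (0<j-i (+<+ py<qy))
        (scaledChord-ℤ {n!} {G u} {u} px py qx qy sp eq)

  G-concave : ∀ s → suc s ℕ.< n → + G s + + G (suc (suc s)) ℤ.≤ + G (suc s) + + G (suc s)
  G-concave s 1+s<n = below-neighbours⇒midpoint {+ G s} {+ G (suc (suc s))} 0<τ
    (subst (λ h → Below h (+ G s)) (ring₋ (+ s)) (G-belowLine (ℕ.≤-trans (ℕ.n≤1+n s) (ℕ.<⇒≤ 1+s<n))))
    (subst (λ h → Below h (+ G (suc (suc s)))) (ring₊ (+ s)) (G-belowLine 1+s<n))
    where
    open SupportingLine (suc s) (s≤s z≤n) 1+s<n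
    ring₋ : ∀ x → x ≡ (1ℤ + x) - 1ℤ
    ring₋ = solve-∀
    ring₊ : ∀ x → 1ℤ + (1ℤ + x) ≡ (1ℤ + x) + 1ℤ
    ring₊ = solve-∀

  δ : ℕ → ℤ
  δ t = + G (suc t) - + G t

  δ-step : ∀ s → suc s ℕ.< n → δ (suc s) ℤ.≤ δ s
  δ-step s 1+s<n = ≤-byDiff (G-concave s 1+s<n) (ring (+ G s) (+ G (suc s)) (+ G (suc (suc s))))
    where
    ring : ∀ a b c → (b - a) - (c - b) ≡ (b + b) - (a + c)
    ring = solve-∀

  δ-antitone : ∀ {i j} → i ℕ.≤ j → j ℕ.< n → δ j ℤ.≤ δ i
  δ-antitone {j = zero} z≤n _ = ℤ.≤-refl
  δ-antitone {i} {suc j} i≤1+j 1+j<n with i ℕ.≟ suc j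
  ... | yes refl = ℤ.≤-refl
  ... | no i≢1+j = ℤ.≤-trans (δ-step j 1+j<n)
                     (δ-antitone (ℕ.≤-pred (ℕ.≤∧≢⇒< i≤1+j i≢1+j)) (ℕ.<-trans (ℕ.n<1+n j) 1+j<n))

  0<δ : ∀ {t} → t ℕ.< n → 0ℤ ℤ.< δ t
  0<δ {t} t<n = ℤ.<-≤-trans 0<δ[n-1] (δ-antitone (ℕ.≤-pred (subst (t ℕ.<_) (sym 1+[n-1]≡n) t<n)) n-1<n)
    where
    1+[n-1]≡n : suc (n ∸ 1) ≡ n
    1+[n-1]≡n = ℕ.m+[n∸m]≡n 1≤n
    n-1<n : n ∸ 1 ℕ.< n
    n-1<n = subst (n ∸ 1 ℕ.<_) 1+[n-1]≡n ℕ.≤-refl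
    0<δ[n-1] : 0ℤ ℤ.< δ (n ∸ 1)
    0<δ[n-1] = 0<j-i (+<+ (subst (G (n ∸ 1) ℕ.<_) (trans (sym Gn≡k*n!) (cong G (sym 1+[n-1]≡n))) G[n-1]<k*n!))

  δ<n! : ∀ {t} → t ℕ.< n → δ t ℤ.< + n!
  δ<n! {t} t<n = ℤ.≤-<-trans (δ-antitone z≤n t<n)
    (subst (ℤ._< + n!) (sym (trans (cong (λ g → + G 1 - + g) G0≡0) (ℤ.+-identityʳ (+ G 1)))) (+<+ G1<n!))

  -- The points of F in terms of G

  reflect : Chord → Chord
  reflect ((px , py) , (qx , qy)) = (k ∸ qx , n ∸ qy) , (k ∸ px , n ∸ py)

  reflect-OnS : ∀ c → OnS c → OnS (reflect c)
  reflect-OnS _ (P∈S , Q∈S) = reflect-∈S Q∈S , reflect-∈S P∈S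

  reflect-spans : ∀ {b} c → b ℕ.≤ n → OnS c → c spans (n ∸ b) → reflect c spans b
  reflect-spans {b} ((px , py) , (qx , qy)) b≤n (_ , Q∈S) (py≤n-b , n-b≤qy , py<qy) =
    subst (n ∸ qy ℕ.≤_) n-[n-b]≡b (ℕ.∸-monoʳ-≤ n n-b≤qy) ,
    subst (ℕ._≤ n ∸ py) n-[n-b]≡b (ℕ.∸-monoʳ-≤ n py≤n-b) ,
    ℕ.∸-monoʳ-< py<qy (∈S⇒y≤n Q∈S)
    where
    n-[n-b]≡b : n ∸ (n ∸ b) ≡ b
    n-[n-b]≡b = ℕ.m∸[m∸n]≡n b≤n

  reflect-rise : ∀ {t} c → OnS c → c spans t → rise (reflect c) ≡ rise c
  reflect-rise ((px , py) , (qx , qy)) (P∈S , Q∈S) (_ , _ , py<qy) = ℤ.+-injective (begin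
    + ((n ∸ py) ∸ (n ∸ qy))          ≡⟨ pos-∸ (ℕ.∸-monoʳ-≤ n (ℕ.<⇒≤ py<qy)) ⟩
    + (n ∸ py) - + (n ∸ qy)          ≡⟨ cong₂ _-_ (pos-∸ (∈S⇒y≤n P∈S)) (pos-∸ (∈S⇒y≤n Q∈S)) ⟩
    (+ n - + py) - (+ n - + qy)      ≡⟨ ring (+ n) (+ py) (+ qy) ⟩
    + qy - + py                      ≡⟨ pos-∸ (ℕ.<⇒≤ py<qy) ⟨
    + (qy ∸ py)                      ∎)
    where
    open ≡-Reasoning
    ring : ∀ n py qy → (n - py) - (n - qy) ≡ qy - py
    ring = solve-∀

  reflect-xAt : ∀ {b} c → b ℕ.≤ n → OnS c → c spans (n ∸ b) →
                xAt b (reflect c) ℕ.+ xAt (n ∸ b) c ≡ k ℕ.* rise c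
  reflect-xAt {b} c@((px , py) , (qx , qy)) b≤n onS@(P∈S , Q∈S) sp@(_ , _ , py<qy) = ℤ.+-injective (begin
    + (xAt b (reflect c) ℕ.+ xAt (n ∸ b) c)
      ≡⟨ ℤ.pos-+ (xAt b (reflect c)) _ ⟩
    + xAt b (reflect c) + + xAt (n ∸ b) c
      ≡⟨ cong₂ _+_ (xAt-ℤ (k ∸ qx) (n ∸ qy) (k ∸ px) (n ∸ py) (reflect-spans c b≤n onS sp))
                   (xAt-ℤ px py qx qy sp) ⟩
    (+ (n ∸ py) - + b) * + (k ∸ qx) + (+ b - + (n ∸ qy)) * + (k ∸ px)
      + ((+ qy - + (n ∸ b)) * + px + (+ (n ∸ b) - + py) * + qx)
      ≡⟨ cong₂ (λ p q → p + ((+ qy - q) * + px + (q - + py) * + qx))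
               (cong₂ (λ u v → (u - + b) * + (k ∸ qx) + (+ b - v) * + (k ∸ px))
                      (pos-∸ (∈S⇒y≤n P∈S)) (pos-∸ (∈S⇒y≤n Q∈S)))
               (pos-∸ b≤n) ⟩
    ((+ n - + py) - + b) * + (k ∸ qx) + (+ b - (+ n - + qy)) * + (k ∸ px)
      + ((+ qy - (+ n - + b)) * + px + ((+ n - + b) - + py) * + qx)
      ≡⟨ cong₂ (λ u v → ((+ n - + py) - + b) * u + (+ b - (+ n - + qy)) * v
                          + ((+ qy - (+ n - + b)) * + px + ((+ n - + b) - + py) * + qx))
               (pos-∸ (∈S⇒x≤k Q∈S)) (pos-∸ (∈S⇒x≤k P∈S)) ⟩
    ((+ n - + py) - + b) * (+ k - + qx) + (+ b - (+ n - + qy)) * (+ k - + px)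
      + ((+ qy - (+ n - + b)) * + px + ((+ n - + b) - + py) * + qx)
      ≡⟨ ring (+ n) (+ k) (+ b) (+ px) (+ py) (+ qx) (+ qy) ⟩
    + k * (+ qy - + py)                 ≡⟨ cong (+ k *_) (pos-∸ (ℕ.<⇒≤ py<qy)) ⟨
    + k * + (qy ∸ py)                   ≡⟨ ℤ.pos-* k (qy ∸ py) ⟨
    + (k ℕ.* rise c)                    ∎)
    where
    open ≡-Reasoning
    ring : ∀ n k b px py qx qy →
      ((n - py) - b) * (k - qx) + (b - (n - qy)) * (k - px) + ((qy - (n - b)) * px + ((n - b) - py) * qx)
      ≡ k * (qy - py)
    ring = solve-∀

  envelope⇒hull : ∀ {a b} → b ℕ.≤ n → n! ℕ.* a ℕ.≤ G b → n! ℕ.* k ℕ.≤ n! ℕ.* a ℕ.+ G (n ∸ b) →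
                  InConvHull S (a , b)
  envelope⇒hull {a} {b} b≤n below-upper above-lower
    with G-attained b≤n | G-attained (ℕ.m∸n≤m n b)
  ... | c , onS@(P∈S , Q∈S) , sp , eq | c′ , onS′ , sp′ , eq′ =
    betweenChords⇒hull S c (reflect c′) P∈S Q∈S (proj₁ (reflect-OnS c′ onS′)) (proj₂ (reflect-OnS c′ onS′))
      sp (reflect-spans c′ b≤n onS′ sp′) ar≤X X₂≤ar′
    where
    open ℕ.≤-Reasoning
    r r′ X X′ : ℕ
    r = rise c
    r′ = rise c′
    X = xAt b c
    X′ = xAt (n ∸ b) c′
    ar≤X : a ℕ.* r ℕ.≤ X
    ar≤X = ℕ.*-cancelˡ-≤ n! {{n ℕ.!≢0}} (begin
      n! ℕ.* (a ℕ.* r)  ≡⟨ ℕ.*-assoc n! a r ⟨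
      n! ℕ.* a ℕ.* r    ≤⟨ ℕ.*-monoˡ-≤ r below-upper ⟩
      G b ℕ.* r         ≡⟨ eq ⟩
      n! ℕ.* X          ∎)
    kr′≤ar′+X′ : k ℕ.* r′ ℕ.≤ a ℕ.* r′ ℕ.+ X′
    kr′≤ar′+X′ = ℕ.*-cancelˡ-≤ n! {{n ℕ.!≢0}} (begin
      n! ℕ.* (k ℕ.* r′)                      ≡⟨ ℕ.*-assoc n! k r′ ⟨
      n! ℕ.* k ℕ.* r′                        ≤⟨ ℕ.*-monoˡ-≤ r′ above-lower ⟩
      (n! ℕ.* a ℕ.+ G (n ∸ b)) ℕ.* r′         ≡⟨ ℕ.*-distribʳ-+ r′ (n! ℕ.* a) (G (n ∸ b)) ⟩
      n! ℕ.* a ℕ.* r′ ℕ.+ G (n ∸ b) ℕ.* r′    ≡⟨ cong (n! ℕ.* a ℕ.* r′ ℕ.+_) eq′ ⟩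
      n! ℕ.* a ℕ.* r′ ℕ.+ n! ℕ.* X′           ≡⟨ cong (ℕ._+ n! ℕ.* X′) (ℕ.*-assoc n! a r′) ⟩
      n! ℕ.* (a ℕ.* r′) ℕ.+ n! ℕ.* X′         ≡⟨ ℕ.*-distribˡ-+ n! (a ℕ.* r′) X′ ⟨
      n! ℕ.* (a ℕ.* r′ ℕ.+ X′)               ∎)
    X₂≤ar′ : xAt b (reflect c′) ℕ.≤ a ℕ.* rise (reflect c′)
    X₂≤ar′ = subst (λ s → xAt b (reflect c′) ℕ.≤ a ℕ.* s) (sym (reflect-rise c′ onS′ sp′))
      (ℕ.+-cancelʳ-≤ X′ _ _ (subst (ℕ._≤ a ℕ.* r′ ℕ.+ X′) (sym (reflect-xAt c′ b≤n onS′ sp′)) kr′≤ar′+X′))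

  ∈F⇒envelope : ∀ {a b} → (a , b) ∈ F → n! ℕ.* a ℕ.≤ G b × n! ℕ.* k ℕ.≤ n! ℕ.* a ℕ.+ G (n ∸ b)
  ∈F⇒envelope {a} {b} a,b∈F = point≤G a,b∈S b<n , (begin
    n! ℕ.* k                          ≡⟨ cong (n! ℕ.*_) (ℕ.m∸n+n≡m a≤k) ⟨
    n! ℕ.* (k ∸ a ℕ.+ a)              ≡⟨ ℕ.*-distribˡ-+ n! (k ∸ a) a ⟩
    n! ℕ.* (k ∸ a) ℕ.+ n! ℕ.* a       ≡⟨ ℕ.+-comm (n! ℕ.* (k ∸ a)) (n! ℕ.* a) ⟩
    n! ℕ.* a ℕ.+ n! ℕ.* (k ∸ a)       ≤⟨ ℕ.+-monoʳ-≤ (n! ℕ.* a) (point≤G (reflect-∈S a,b∈S) n-b<n) ⟩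
    n! ℕ.* a ℕ.+ G (n ∸ b)            ∎)
    where
    open ℕ.≤-Reasoning
    a,b∈S : (a , b) ∈ S
    a,b∈S = there (there a,b∈F)
    a≤k : a ℕ.≤ k
    a≤k = ∈S⇒x≤k a,b∈S
    b<n : b ℕ.< n
    b<n = ℕ.≤-trans (ℕ.n≤1+n (suc b)) (FmaxBounds.2+y≤n (bounds a,b∈F))
    n-b<n : n ∸ b ℕ.< n
    n-b<n = ℕ.∸-monoʳ-< (ℕ.≤-trans (s≤s z≤n) (FmaxBounds.2≤y (bounds a,b∈F))) (ℕ.<⇒≤ b<n)

  envelope⇒∈F : ∀ {a b} → 1 ℕ.≤ a → a ℕ.≤ k ∸ 1 → b ℕ.≤ n →
    n! ℕ.* a ℕ.≤ G b → n! ℕ.* k ℕ.≤ n! ℕ.* a ℕ.+ G (n ∸ b) → (a , b) ∈ F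
  envelope⇒∈F 1≤a a≤k-1 b≤n below-upper above-lower
    with convex _ (envelope⇒hull b≤n below-upper above-lower)
  ... | here refl = ⊥-elim (ℕ.<-irrefl refl 1≤a)
  ... | there (here refl) = ⊥-elim (ℕ.<-irrefl refl (≤∸1⇒< 1≤a a≤k-1))
  ... | there (there a,b∈F) = a,b∈F

  -- The profile H

  D-1 : ℕ
  D-1 = n ℕ.* n! ∸ 1

  +D≡n*n! : + suc D-1 ≡ + n * + n!
  +D≡n*n! = trans (cong +_ (ℕ.m+[n∸m]≡n (ℕ.*-mono-≤ 1≤n (ℕ.1≤n! n)))) (ℤ.pos-* n n!)

  open OverDenominator D-1

  -- adding t mod n keeps the fractional parts of H pairwise distinct
  numerator : ℕ → ℕ
  numerator t = n ℕ.* G t ℕ.+ t % n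

  -- abstract: normalising these rationals makes typechecking blow up
  abstract
    H : ℕ → ℚ
    H t = (+ numerator t) / suc D-1

    H-def : ∀ t → H t ≡ (+ numerator t) / suc D-1
    H-def t = refl

  numerator-ℤ : ∀ t → + numerator t ≡ + n * + G t + + (t % n)
  numerator-ℤ t = trans (ℤ.pos-+ (n ℕ.* G t) (t % n)) (cong (_+ + (t % n)) (ℤ.pos-* n (G t)))

  jump : ℕ → ℤ
  jump t = + (suc t % n) - + (t % n)

  jump-cases : ∀ {t} → t ℕ.< n → jump t ≡ 1ℤ ⊎ (suc t ≡ n × jump t ≡ 1ℤ - + n)
  jump-cases {t} t<n with suc t ℕ.<? n
  ... | yes 1+t<n =
    inj₁ (trans (cong₂ (λ a b → + a - + b) (ℕ.m<n⇒m%n≡m 1+t<n) (ℕ.m<n⇒m%n≡m t<n)) (ring (+ t)))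
    where
    ring : ∀ x → (1ℤ + x) - x ≡ 1ℤ
    ring = solve-∀
  ... | no 1+t≮n = inj₂ (1+t≡n ,
    trans (cong₂ (λ a b → + a - + b) (trans (cong (_% n) 1+t≡n) (ℕ.n%n≡0 n)) (ℕ.m<n⇒m%n≡m t<n))
          (trans (ring (+ t)) (cong (λ m → 1ℤ - + m) 1+t≡n)))
    where
    1+t≡n : suc t ≡ n
    1+t≡n = ℕ.≤-antisym t<n (ℕ.≮⇒≥ 1+t≮n)
    ring : ∀ x → 0ℤ - x ≡ 1ℤ - (1ℤ + x)
    ring = solve-∀

  1-n≤1 : 1ℤ - + n ℤ.≤ 1ℤ
  1-n≤1 = ℤ.i≤j⇒i-k≤j (+ n) ℤ.≤-refl

  jump≤1 : ∀ {t} → t ℕ.< n → jump t ℤ.≤ 1ℤ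
  jump≤1 t<n with jump-cases t<n
  ... | inj₁ jump≡1 = ℤ.≤-reflexive jump≡1
  ... | inj₂ (_ , jump≡1-n) = subst (ℤ._≤ 1ℤ) (sym jump≡1-n) 1-n≤1

  1-n≤jump : ∀ {t} → t ℕ.< n → 1ℤ - + n ℤ.≤ jump t
  1-n≤jump t<n with jump-cases t<n
  ... | inj₁ jump≡1 = subst (1ℤ - + n ℤ.≤_) (sym jump≡1) 1-n≤1
  ... | inj₂ (_ , jump≡1-n) = ℤ.≤-reflexive (sym jump≡1-n)

  jump-antitone : ∀ {i j} → i ℕ.≤ j → j ℕ.< n → jump j ℤ.≤ jump i
  jump-antitone {i} {j} i≤j j<n with jump-cases (ℕ.≤-<-trans i≤j j<n)
  ... | inj₁ jump≡1 = subst (jump j ℤ.≤_) (sym jump≡1) (jump≤1 j<n)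
  ... | inj₂ (1+i≡n , _) =
    ℤ.≤-reflexive (cong jump (ℕ.≤-antisym (ℕ.≤-pred (subst (j ℕ.<_) (sym 1+i≡n) j<n)) i≤j))

  H-step : ∀ t → H (suc t) ℚ.- H t ≡ (+ n * δ t + jump t) / suc D-1
  H-step t = begin
    H (suc t) ℚ.- H t                                    ≡⟨ cong₂ ℚ._-_ (H-def (suc t)) (H-def t) ⟩
    (+ numerator (suc t)) / suc D-1 ℚ.- (+ numerator t) / suc D-1
                                                         ≡⟨ x/d-y/d≡[x-y]/d (+ numerator (suc t)) (+ numerator t) ⟩
    (+ numerator (suc t) - + numerator t) / suc D-1      ≡⟨ cong (_/ suc D-1) numerator-step ⟩
    (+ n * δ t + jump t) / suc D-1                       ∎
    where
    open ≡-Reasoning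
    ring : ∀ n a b r s → (n * a + r) - (n * b + s) ≡ n * (a - b) + (r - s)
    ring = solve-∀
    numerator-step : + numerator (suc t) - + numerator t ≡ + n * δ t + jump t
    numerator-step = trans (cong₂ _-_ (numerator-ℤ (suc t)) (numerator-ℤ t))
      (ring (+ n) (+ G (suc t)) (+ G t) (+ (suc t % n)) (+ (t % n)))

  H0≡0 : H 0 ≡ 0ℚ
  H0≡0 = trans (H-def 0) (trans (cong (λ m → (+ m) / suc D-1)
                 (cong₂ ℕ._+_ (trans (cong (n ℕ.*_) G0≡0) (ℕ.*-zeroʳ n)) (ℕ.m<n⇒m%n≡m 1≤n)))
               (ℚ.0/n≡0 (suc D-1)))
  Hn≡k : H n ≡ ⟦ k ⟧
  Hn≡k = trans (H-def n) (trans (cong (_/ suc D-1) numerator≡) (sym (z/1≡[z*d]/d (+ k))))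
    where
    ring : ∀ n k m → n * (k * m) + 0ℤ ≡ k * (n * m)
    ring = solve-∀
    numerator≡ : + numerator n ≡ + k * + suc D-1
    numerator≡ = begin
      + numerator n                  ≡⟨ numerator-ℤ n ⟩
      + n * + G n + + (n % n)        ≡⟨ cong₂ (λ g r → + n * + g + + r) Gn≡k*n! (ℕ.n%n≡0 n) ⟩
      + n * + (k ℕ.* n!) + 0ℤ        ≡⟨ cong (λ z → + n * z + 0ℤ) (ℤ.pos-* k n!) ⟩
      + n * (+ k * + n!) + 0ℤ        ≡⟨ ring (+ n) (+ k) (+ n!) ⟩
      + k * (+ n * + n!)             ≡⟨ cong (+ k *_) +D≡n*n! ⟨
      + k * + suc D-1                ∎
      where open ≡-Reasoning
  H-steps : ∀ i → i ℕ.< n → (0ℚ ℚ.< H (suc i) ℚ.- H i) × (H (suc i) ℚ.- H i ℚ.< 1ℚ)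
  H-steps i i<n =
    subst₂ ℚ._<_ (ℚ.0/n≡0 (suc D-1)) (sym (H-step i))
      (/-mono-< (0<n*δ+s {n} {δ i} {jump i} (0<δ i<n) (1-n≤jump i<n))) ,
    subst₂ ℚ._<_ (sym (H-step i)) (sym (z/1≡[z*d]/d 1ℤ))
      (/-mono-< (subst (+ n * δ i + jump i ℤ.<_) (trans (sym +D≡n*n!) (sym (ℤ.*-identityˡ (+ suc D-1))))
        (n*δ+s<n*d {n} {δ i} {jump i} {+ n!} 2≤n (δ<n! i<n) (jump≤1 i<n))))
  H-concave : ∀ i j → i ℕ.≤ j → j ℕ.< n → H (suc j) ℚ.- H j ℚ.≤ H (suc i) ℚ.- H i
  H-concave i j i≤j j<n = subst₂ ℚ._≤_ (sym (H-step j)) (sym (H-step i))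
    (/-mono-≤ (ℤ.+-mono-≤ (ℤ.*-monoˡ-≤-nonNeg (+ n) (δ-antitone i≤j j<n)) (jump-antitone i≤j j<n)))
  numerator-injective-mod : ∀ {i j} z → i ℕ.< n → j ℕ.< n →
    + numerator i ≡ + numerator j + z * + suc D-1 → i ≡ j
  numerator-injective-mod {i} {j} z i<n j<n i≡j+zD =
    +i-+j≡n*w⇒i≡j (z * + n! + + G j - + G i) i<n j<n (begin
    + i - + j                                                  ≡⟨ ring₁ (+ n * + G i) (+ i) (+ j) ⟩
    (+ n * + G i + + i) - + n * + G i - + j                    ≡⟨ cong (λ w → w - + n * + G i - + j) i≡ ⟩
    (+ n * + G j + + j + z * (+ n * + n!)) - + n * + G i - + j
      ≡⟨ ring₂ (+ n) (+ G i) (+ G j) (+ j) z (+ n!) ⟩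
    + n * (z * + n! + + G j - + G i)                           ∎)
    where
    open ≡-Reasoning
    residue : ∀ {t} → t ℕ.< n → + numerator t ≡ + n * + G t + + t
    residue {t} t<n = trans (numerator-ℤ t) (cong (λ r → + n * + G t + + r) (ℕ.m<n⇒m%n≡m t<n))
    i≡ : + n * + G i + + i ≡ + n * + G j + + j + z * (+ n * + n!)
    i≡ = trans (sym (residue i<n)) (trans i≡j+zD (cong₂ (λ a d → a + z * d) (residue j<n) +D≡n*n!))
    ring₁ : ∀ a i j → i - j ≡ (a + i) - a - j
    ring₁ = solve-∀
    ring₂ : ∀ n gi gj j z m → (n * gj + j + z * (n * m)) - n * gi - j ≡ n * (z * m + gj - gi)
    ring₂ = solve-∀

  fracs-distinct : ∀ i j → i ℕ.< n → j ℕ.< n → i ≢ j → frac (H i) ≢ frac (H j)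
  fracs-distinct i j i<n j<n i≢j eq = i≢j (numerator-injective-mod z i<n j<n i≡j+zD)
    where
    z,i≡j+zD = frac-/-injective-mod (+ numerator i) (+ numerator j)
                 (subst₂ (λ p q → frac p ≡ frac q) (H-def i) (H-def j) eq)
    z = proj₁ z,i≡j+zD
    i≡j+zD = proj₂ z,i≡j+zD

  H-isConcaveProfile : ConcaveProfile k n H
  H-isConcaveProfile = H0≡0 , Hn≡k , H-steps , H-concave , fracs-distinct

  ⟦⟧≡ : ∀ a → ⟦ a ⟧ ≡ (+ (n ℕ.* (n! ℕ.* a))) / suc D-1
  ⟦⟧≡ a = trans (z/1≡[z*d]/d (+ a)) (cong (_/ suc D-1) (begin
    + a * + suc D-1           ≡⟨ cong (+ a *_) +D≡n*n! ⟩
    + a * (+ n * + n!)        ≡⟨ ring (+ a) (+ n) (+ n!) ⟩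
    + n * (+ n! * + a)        ≡⟨ cong (+ n *_) (ℤ.pos-* n! a) ⟨
    + n * + (n! ℕ.* a)        ≡⟨ ℤ.pos-* n (n! ℕ.* a) ⟨
    + (n ℕ.* (n! ℕ.* a))      ∎))
    where
    open ≡-Reasoning
    ring : ∀ a n m → a * (n * m) ≡ n * (m * a)
    ring = solve-∀

  ⟦⟧≤H⇔ : ∀ {a b} → (⟦ a ⟧ ℚ.≤ H b) ⇔ (n! ℕ.* a ℕ.≤ G b)
  ⟦⟧≤H⇔ {a} {b} = ⇔-trans
    (mk⇔ (λ le → ℤ.drop‿+≤+ (/-cancel-≤ (subst₂ ℚ._≤_ (⟦⟧≡ a) (H-def b) le)))
         (λ le → subst₂ ℚ._≤_ (sym (⟦⟧≡ a)) (sym (H-def b)) (/-mono-≤ (+≤+ le))))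
    (n*y≤n*x+r⇔y≤x n (ℕ.m%n<n b n))

  ⟦k⟧-H≤⟦⟧⇔ : ∀ {a m} → (⟦ k ⟧ ℚ.- H m ℚ.≤ ⟦ a ⟧) ⇔ (n! ℕ.* k ℕ.≤ n! ℕ.* a ℕ.+ G m)
  ⟦k⟧-H≤⟦⟧⇔ {a} {m} = ⇔-trans (mk⇔ to from) (n*y≤n*x+r⇔y≤x n (ℕ.m%n<n m n))
    where
    K A : ℕ
    K = n ℕ.* (n! ℕ.* k)
    A = n ℕ.* (n! ℕ.* a)
    ring : ∀ n m a g r → n ℕ.* (m ℕ.* a) ℕ.+ (n ℕ.* g ℕ.+ r) ≡ n ℕ.* (m ℕ.* a ℕ.+ g) ℕ.+ r
    ring = ℕ-Ring.solve-∀
    regroup : + (A ℕ.+ numerator m) ≡ + (n ℕ.* (n! ℕ.* a ℕ.+ G m) ℕ.+ m % n)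
    regroup = cong +_ (ring n n! a (G m) (m % n))
    lhs≡ : ⟦ k ⟧ ℚ.- H m ≡ (+ K - + numerator m) / suc D-1
    lhs≡ = trans (cong₂ ℚ._-_ (⟦⟧≡ k) (H-def m)) (x/d-y/d≡[x-y]/d (+ K) (+ numerator m))
    to : ⟦ k ⟧ ℚ.- H m ℚ.≤ ⟦ a ⟧ → K ℕ.≤ n ℕ.* (n! ℕ.* a ℕ.+ G m) ℕ.+ m % n
    to le = ℤ.drop‿+≤+ (subst (+ K ℤ.≤_) (trans (sym (ℤ.pos-+ A (numerator m))) regroup)
      (-≤⇒≤+ {+ K} {+ numerator m} {+ A} (/-cancel-≤ (subst₂ ℚ._≤_ lhs≡ (⟦⟧≡ a) le))))
    from : K ℕ.≤ n ℕ.* (n! ℕ.* a ℕ.+ G m) ℕ.+ m % n → ⟦ k ⟧ ℚ.- H m ℚ.≤ ⟦ a ⟧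
    from le = subst₂ ℚ._≤_ (sym lhs≡) (sym (⟦⟧≡ a))
      (/-mono-≤ (≤+⇒-≤ {+ K} {+ numerator m} {+ A}
        (subst (+ K ℤ.≤_) (trans (sym regroup) (ℤ.pos-+ A (numerator m))) (+≤+ le))))

  ∈F⇒F′ : ∀ {a b} → (a , b) ∈ F → InF'H k n H (a , b)
  ∈F⇒F′ {a} {b} a,b∈F =
    1≤x , <⇒≤∸1 x<k , ℕ.≤-trans (s≤s z≤n) 2≤y , <⇒≤∸1 (ℕ.≤-trans (ℕ.n≤1+n (suc b)) 2+y≤n) ,
    Equivalence.from ⟦k⟧-H≤⟦⟧⇔ (proj₂ (∈F⇒envelope a,b∈F)) ,
    Equivalence.from ⟦⟧≤H⇔ (proj₁ (∈F⇒envelope a,b∈F))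
    where open FmaxBounds (bounds a,b∈F)

  F′⇒∈F : ∀ {a b} → InF'H k n H (a , b) → (a , b) ∈ F
  F′⇒∈F (1≤a , a≤k-1 , 1≤b , b≤n-1 , k-H≤a , a≤H) =
    envelope⇒∈F 1≤a a≤k-1 (ℕ.<⇒≤ (≤∸1⇒< 1≤b b≤n-1))
      (Equivalence.to ⟦⟧≤H⇔ a≤H) (Equivalence.to ⟦k⟧-H≤⟦⟧⇔ k-H≤a)

proposition6p2 : (k n : ℕ) → 1 ℕ.≤ k → k ℕ.≤ n ∸ 1 → (F : List Point) →
    F ⊆Fmax[ k , n ] → Convex k n F → CentrallySymmetric k n F →
    Σ (ℕ → ℚ) (λ H → ConcaveProfile k n H × (∀ p → (p ∈ F ⇔ InF'H k n H p)))
proposition6p2 k n 1≤k k≤n-1 F F⊆Fmax convex symmetric = H , H-isConcaveProfile , λ _ → mk⇔ ∈F⇒F′ F′⇒∈F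
  where open Realisation k n F 1≤k k≤n-1 F⊆Fmax convex symmetric
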